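{- Let $(E,+,{}',0,1)$ be a lattice effect algebra with induced order $\leq$ and join $\vee$, and define the natural implication $x\rightarrow y:=y+(x\vee y)'$ for all $x,y\in E$. Then for all $a,b,c\in E$: (i) $a\leq b$ if and only if $a\rightarrow b=1$; (ii) if $a\leq b'$ then $a+b=a'\rightarrow b$; (iii) if $a\geq b$ then $a\rightarrow b=a'+b$; (iv) if $a\geq b$ then $a\rightarrow b=b'\rightarrow a'$; (v) if $a\leq b$ then $b\rightarrow c\leq a\rightarrow c$.
   Context: An effect algebra is a structure $(E,+,{}',0,1)$ where $E$ is a set, ${}'$ is a unary operation on $E$, $0,1\in E$, and $+$ is a partial binary operation on $E$ such that for all $x,y,z\in E$: (E1) if $x+y$ is defined then so is $y+x$ and $x+y=y+x$; (E2) $(x+y)+z$ is defined if and only if $x+(y+z)$ is defined, and then they are equal; (E3) $x+y$ is defined and equals $1$ if and only if $y=x'$; (E4) if $1+x$ is defined then $x=0$. The induced order is defined by $x\leq y$ iff there exists $z\in E$ with $x+z=y$; it is a partial order with least element $0$ and greatest element $1$. The effect algebra is a lattice effect algebra if $(E,\leq)$ is a lattice; $\vee$ and $\wedge$ denote its join and meet. -}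

module Defs where

open import Level using (Level; suc; _⊔_)
open import Data.Maybe using (Maybe; just; nothing)
open import Data.Product using (Σ; ∃; _×_; _,_)
open import Relation.Binary.PropositionalEquality using (_≡_)

-- An effect algebra (E, +, ′, 0, 1).  The partial operation + is modelled
-- as a total function into Maybe E: x ⊕ y ≡ nothing means "x + y undefined".
record EffectAlgebra (ℓ : Level) : Set (suc ℓ) where
  infixl 6 _⊕_
  infix 8 _′
  field
    E   : Set ℓ
    _⊕_ : E → E → Maybe E
    _′  : E → E
    𝟎   : E
    𝟏   : E
    comm  : ∀ x y z → x ⊕ y ≡ just z → y ⊕ x ≡ just z
    assoc : ∀ x y z w →
      (∃ λ u → x ⊕ y ≡ just u × u ⊕ z ≡ just w) →
      (∃ λ v → y ⊕ z ≡ just v × x ⊕ v ≡ just w)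
    assoc⁻ : ∀ x y z w →
      (∃ λ v → y ⊕ z ≡ just v × x ⊕ v ≡ just w) →
      (∃ λ u → x ⊕ y ≡ just u × u ⊕ z ≡ just w)
    orth  : ∀ x y → x ⊕ y ≡ just 𝟏 → y ≡ x ′
    orth⁻ : ∀ x → x ⊕ (x ′) ≡ just 𝟏
    zero-one : ∀ x z → 𝟏 ⊕ x ≡ just z → x ≡ 𝟎

  _≤_ : E → E → Set ℓ
  x ≤ y = ∃ λ z → x ⊕ z ≡ just y

record LatticeEffectAlgebra (ℓ : Level) : Set (suc ℓ) where
  field
    effectAlgebra : EffectAlgebra ℓ
  open EffectAlgebra effectAlgebra public
  infixr 5 _∨_
  infixr 6 _∧_
  field
    _∨_ : E → E → E
    _∧_ : E → E → E
    ∨-upperˡ : ∀ x y → x ≤ (x ∨ y)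
    ∨-upperʳ : ∀ x y → y ≤ (x ∨ y)
    ∨-least  : ∀ x y z → x ≤ z → y ≤ z → (x ∨ y) ≤ z
    ∧-lowerˡ : ∀ x y → (x ∧ y) ≤ x
    ∧-lowerʳ : ∀ x y → (x ∧ y) ≤ y
    ∧-greatest : ∀ x y z → z ≤ x → z ≤ y → z ≤ (x ∧ y)

  -- natural implication:  x → y = z  means  y + (x ∨ y)′ is defined and equals z
  -- (y + (x ∨ y)′ is always defined, since y ≤ x ∨ y).
  _⇒_≐_ : E → E → E → Set ℓ
  x ⇒ y ≐ z = y ⊕ ((x ∨ y) ′) ≡ just z

module Submission where

-- When x and y are comparable, x ∨ y is one of them, so x → y reduces to y + x′
-- (if y ≤ x) or to y + y′ = 1 (if x ≤ y); (i)–(iv) are these reductions combined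
-- with x″ = x.  For (v), x ≤ y gives (y ∨ c)′ ≤ (x ∨ c)′, and c + (−) is monotone.

open import Defs
open import Level using (Level)
open import Data.Maybe using (just)
open import Data.Maybe.Properties using (just-injective)
open import Data.Product using (∃; _×_; _,_)
open import Relation.Binary.PropositionalEquality
  using (_≡_; refl; sym; trans; cong; subst; module ≡-Reasoning)
open import Function.Bundles using (_⇔_; mk⇔)

module EffectAlgebraProperties {ℓ : Level} (A : EffectAlgebra ℓ) where
  open EffectAlgebra A

  ′-involutive : ∀ x → (x ′) ′ ≡ x
  ′-involutive x = sym (orth (x ′) x (comm x (x ′) 𝟏 (orth⁻ x)))

  ′-injective : ∀ {x y} → x ′ ≡ y ′ → x ≡ y
  ′-injective {x} {y} p = begin
    x         ≡⟨ sym (′-involutive x) ⟩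
    (x ′) ′   ≡⟨ cong _′ p ⟩
    (y ′) ′   ≡⟨ ′-involutive y ⟩
    y         ∎
    where open ≡-Reasoning

  𝟏′≡𝟎 : 𝟏 ′ ≡ 𝟎
  𝟏′≡𝟎 = zero-one (𝟏 ′) 𝟏 (orth⁻ 𝟏)

  𝟎⊕𝟏≡𝟏 : 𝟎 ⊕ 𝟏 ≡ just 𝟏
  𝟎⊕𝟏≡𝟏 = subst (λ t → t ⊕ 𝟏 ≡ just 𝟏) 𝟏′≡𝟎 (comm 𝟏 (𝟏 ′) 𝟏 (orth⁻ 𝟏))

  ⊕-identityʳ : ∀ x → x ⊕ 𝟎 ≡ just x
  ⊕-identityʳ x
    with assoc (x ′) x 𝟎 𝟏 (𝟏 , comm x (x ′) 𝟏 (orth⁻ x) , comm 𝟎 𝟏 𝟏 𝟎⊕𝟏≡𝟏)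
  ... | v , x⊕𝟎≡v , x′⊕v≡𝟏 =
    subst (λ t → x ⊕ 𝟎 ≡ just t)
      (trans (orth (x ′) v x′⊕v≡𝟏) (′-involutive x)) x⊕𝟎≡v

  -- Regroup x + y + w′ = 1 as y + (w′ + x) = 1 and apply (E3).
  complement-of-sum : ∀ {x y w} → x ⊕ y ≡ just w → (w ′) ⊕ x ≡ just (y ′)
  complement-of-sum {x} {y} {w} x⊕y≡w
    with assoc x y (w ′) 𝟏 (w , x⊕y≡w , orth⁻ w)
  ... | v , y⊕w′≡v , x⊕v≡𝟏 with orth x v x⊕v≡𝟏
  ... | refl with assoc y (w ′) x 𝟏 (x ′ , y⊕w′≡v , comm x (x ′) 𝟏 (orth⁻ x))
  ... | t , w′⊕x≡t , y⊕t≡𝟏 =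
    subst (λ s → (w ′) ⊕ x ≡ just s) (orth y t y⊕t≡𝟏) w′⊕x≡t

  ⊕-cancelˡ : ∀ {x y z w} → x ⊕ y ≡ just w → x ⊕ z ≡ just w → y ≡ z
  ⊕-cancelˡ p q = ′-injective
    (just-injective (trans (sym (complement-of-sum p)) (complement-of-sum q)))

  ⊕-defined⇒≤′ : ∀ {x y w} → x ⊕ y ≡ just w → y ≤ (x ′)
  ⊕-defined⇒≤′ {x} {y} {w} x⊕y≡w
    with assoc x y (w ′) 𝟏 (w , x⊕y≡w , orth⁻ w)
  ... | v , y⊕w′≡v , x⊕v≡𝟏 =
    w ′ , subst (λ t → y ⊕ (w ′) ≡ just t) (orth x v x⊕v≡𝟏) y⊕w′≡v

  ≤′⇒⊕-defined : ∀ {x y} → y ≤ (x ′) → ∃ λ z → x ⊕ y ≡ just z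
  ≤′⇒⊕-defined {x} {y} (t , y⊕t≡x′) with assoc⁻ x y t 𝟏 (x ′ , y⊕t≡x′ , orth⁻ x)
  ... | u , x⊕y≡u , _ = u , x⊕y≡u

  zero-sum : ∀ {u v} → u ⊕ v ≡ just 𝟎 → u ≡ 𝟎
  zero-sum {u} {v} u⊕v≡𝟎 with assoc u v 𝟏 𝟏 (𝟎 , u⊕v≡𝟎 , 𝟎⊕𝟏≡𝟏)
  ... | s , v⊕𝟏≡s , u⊕s≡𝟏 with zero-one v s (comm v 𝟏 s v⊕𝟏≡s)
  ... | refl with just-injective (trans (sym v⊕𝟏≡s) 𝟎⊕𝟏≡𝟏)
  ... | refl = zero-one u 𝟏 (comm u 𝟏 𝟏 u⊕s≡𝟏)

  ≤-refl : ∀ x → x ≤ x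
  ≤-refl x = 𝟎 , ⊕-identityʳ x

  ≤-trans : ∀ {x y z} → x ≤ y → y ≤ z → x ≤ z
  ≤-trans {x} {y} {z} (u , x⊕u≡y) (v , y⊕v≡z) with assoc x u v z (y , x⊕u≡y , y⊕v≡z)
  ... | s , _ , x⊕s≡z = s , x⊕s≡z

  ≤-antisym : ∀ {x y} → x ≤ y → y ≤ x → x ≡ y
  ≤-antisym {x} {y} (u , x⊕u≡y) (v , y⊕v≡x)
    with assoc x u v x (y , x⊕u≡y , y⊕v≡x)
  ... | s , u⊕v≡s , x⊕s≡x with ⊕-cancelˡ x⊕s≡x (⊕-identityʳ x)
  ... | refl with zero-sum u⊕v≡s
  ... | refl = just-injective (trans (sym (⊕-identityʳ x)) x⊕u≡y)

  ′-antitone : ∀ {x y} → x ≤ y → (y ′) ≤ (x ′)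
  ′-antitone {x} {y} (u , x⊕u≡y) with assoc x u (y ′) 𝟏 (y , x⊕u≡y , orth⁻ y)
  ... | s , u⊕y′≡s , x⊕s≡𝟏 =
    u , comm u (y ′) (x ′) (subst (λ t → u ⊕ (y ′) ≡ just t) (orth x s x⊕s≡𝟏) u⊕y′≡s)

  ⊕-monoʳ-≤ : ∀ {x y c u v} → x ≤ y → c ⊕ x ≡ just u → c ⊕ y ≡ just v → u ≤ v
  ⊕-monoʳ-≤ {x} {y} {c} {u} {v} (t , x⊕t≡y) c⊕x≡u c⊕y≡v
    with assoc⁻ c x t v (y , x⊕t≡y , c⊕y≡v)
  ... | u' , c⊕x≡u' , u'⊕t≡v =
    t , subst (λ s → s ⊕ t ≡ just v) (just-injective (trans (sym c⊕x≡u') c⊕x≡u)) u'⊕t≡v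

module LatticeEffectAlgebraProperties {ℓ : Level} (L : LatticeEffectAlgebra ℓ) where
  open LatticeEffectAlgebra L
  open EffectAlgebraProperties effectAlgebra

  ∨-of-≤ : ∀ {x y} → x ≤ y → x ∨ y ≡ y
  ∨-of-≤ {x} {y} x≤y = ≤-antisym (∨-least x y y x≤y (≤-refl y)) (∨-upperʳ x y)

  ∨-of-≥ : ∀ {x y} → y ≤ x → x ∨ y ≡ x
  ∨-of-≥ {x} {y} y≤x = ≤-antisym (∨-least x y x (≤-refl x) y≤x) (∨-upperˡ x y)

  ∨-monoˡ-≤ : ∀ {x y} z → x ≤ y → (x ∨ z) ≤ (y ∨ z)
  ∨-monoˡ-≤ {x} {y} z x≤y =
    ∨-least x z (y ∨ z) (≤-trans x≤y (∨-upperˡ y z)) (∨-upperʳ y z)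

  ⇒-defined : ∀ x y → ∃ λ z → x ⇒ y ≐ z
  ⇒-defined x y = ≤′⇒⊕-defined (′-antitone (∨-upperʳ x y))

  ⇒-of-≥ : ∀ {x y z} → y ≤ x → y ⊕ (x ′) ≡ just z → x ⇒ y ≐ z
  ⇒-of-≥ {x} {y} {z} y≤x = subst (λ t → y ⊕ (t ′) ≡ just z) (sym (∨-of-≥ y≤x))

  ≤⇔⇒𝟏 : ∀ {x y} → x ≤ y ⇔ (x ⇒ y ≐ 𝟏)
  ≤⇔⇒𝟏 {x} {y} = mk⇔ to from
    where
    to : x ≤ y → x ⇒ y ≐ 𝟏
    to x≤y = subst (λ t → y ⊕ (t ′) ≡ just 𝟏) (sym (∨-of-≤ x≤y)) (orth⁻ y)
    from : x ⇒ y ≐ 𝟏 → x ≤ y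
    from x⇒y≐𝟏 = subst (x ≤_) x∨y≡y (∨-upperˡ x y)
      where
      x∨y≡y : x ∨ y ≡ y
      x∨y≡y = ′-injective (orth y ((x ∨ y) ′) x⇒y≐𝟏)

  ⊕-as-⇒ : ∀ {x y} → x ≤ (y ′) → ∃ λ z → x ⊕ y ≡ just z × ((x ′) ⇒ y ≐ z)
  ⊕-as-⇒ {x} {y} x≤y′ with ≤′⇒⊕-defined x≤y′
  ... | z , y⊕x≡z =
    z , x⊕y≡z , ⇒-of-≥ (⊕-defined⇒≤′ x⊕y≡z)
                  (subst (λ t → y ⊕ t ≡ just z) (sym (′-involutive x)) y⊕x≡z)
    where
    x⊕y≡z : x ⊕ y ≡ just z
    x⊕y≡z = comm y x z y⊕x≡z

  ⇒-as-⊕ : ∀ {x y} → y ≤ x → ∃ λ z → (x ⇒ y ≐ z) × (x ′) ⊕ y ≡ just z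
  ⇒-as-⊕ {x} {y} y≤x with ≤′⇒⊕-defined (′-antitone y≤x)
  ... | z , y⊕x′≡z = z , ⇒-of-≥ y≤x y⊕x′≡z , comm y (x ′) z y⊕x′≡z

  ⇒-contrapositive : ∀ {x y} → y ≤ x → ∃ λ z → (x ⇒ y ≐ z) × ((y ′) ⇒ (x ′) ≐ z)
  ⇒-contrapositive {x} {y} y≤x with ⇒-as-⊕ y≤x
  ... | z , x⇒y≐z , x′⊕y≡z =
    z , x⇒y≐z , ⇒-of-≥ (′-antitone y≤x)
                  (subst (λ t → (x ′) ⊕ t ≡ just z) (sym (′-involutive y)) x′⊕y≡z)

  ⇒-antitoneˡ : ∀ {x y} z → x ≤ y →
    ∃ λ u → ∃ λ v → (y ⇒ z ≐ u) × (x ⇒ z ≐ v) × u ≤ v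
  ⇒-antitoneˡ {x} {y} z x≤y with ⇒-defined y z | ⇒-defined x z
  ... | u , y⇒z≐u | v , x⇒z≐v =
    u , v , y⇒z≐u , x⇒z≐v , ⊕-monoʳ-≤ (′-antitone (∨-monoˡ-≤ z x≤y)) y⇒z≐u x⇒z≐v

theorem2p1 : ∀ {ℓ : Level} (L : LatticeEffectAlgebra ℓ) →
    let open LatticeEffectAlgebra L in
    ∀ a b c →
      -- (i)
      (a ≤ b ⇔ (a ⇒ b ≐ 𝟏))
      -- (ii)
      × (a ≤ (b ′) → ∃ λ z → a ⊕ b ≡ just z × ((a ′) ⇒ b ≐ z))
      -- (iii)
      × (b ≤ a → ∃ λ z → (a ⇒ b ≐ z) × (a ′) ⊕ b ≡ just z)
      -- (iv)
      × (b ≤ a → ∃ λ z → (a ⇒ b ≐ z) × ((b ′) ⇒ (a ′) ≐ z))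
      -- (v)
      × (a ≤ b → ∃ λ u → ∃ λ v → (b ⇒ c ≐ u) × (a ⇒ c ≐ v) × u ≤ v)
theorem2p1 L a b c =
  ≤⇔⇒𝟏 , ⊕-as-⇒ , ⇒-as-⊕ , ⇒-contrapositive , ⇒-antitoneˡ c
  where open LatticeEffectAlgebraProperties L
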